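{- Let $X$ be a connected multiplicity graph of total multiplicity $n$ with lift $X'$, and let $\alpha,\beta$ be acyclic orientations of $\overline{X'}$ with $\alpha\simeq\beta$. Then $\pi_\alpha=\pi_\beta$.
   Context: The lift $X'$ of a multiplicity graph $X$ (multiplicities $c_v$) is the simple graph on $\bigsqcup_v S_v$, $|S_v|=c_v$, each $S_v$ a clique and $u'\in S_u,v'\in S_v$ ($u\ne v$) adjacent iff $uv\in E(X)$; $\pi$ maps $S_v$ to $v$; $\overline{X'}$ is the complement of $X'$. For a bijection $\sigma:[n]\to V(\overline{X'})$, $\alpha_{\overline{X'}}(\sigma)$ orients each edge $uv$ as $u\to v$ iff $\sigma^{ -1}(u)<\sigma^{ -1}(v)$; the linear extensions of an acyclic orientation $\alpha$ are the bijections $\sigma$ with $\alpha_{\overline{X'}}(\sigma)=\alpha$. Let $\varphi(k)=k+1$ for $k<n$, $\varphi(n)=1$. The period of a bijection $\sigma$ is the least $t\geq1$ with $\pi\circ\sigma\circ\varphi^t=\pi\circ\sigma$; the period $\pi_\alpha$ of $\alpha$ is the least period of a linear extension of $\alpha$. Let $\mathfrak{S}_X$ be the group of permutations $\rho$ of $V(X')$ with $\rho(S_v)=S_v$ for all $v$; $\alpha\equiv\beta$ if some $\rho\in\mathfrak{S}_X$ satisfies $u\to_\alpha v\iff\rho(u)\to_\beta\rho(v)$. A flip at a source (all incident edges outgoing) or sink (all incident edges incoming) reverses all its incident edges; $\alpha\sim\beta$ (toric equivalence) if one is obtained from the other by a sequence of flips. $\alpha\simeq\beta$ if there is a sequence $\alpha=\alpha_0,\dots,\alpha_s=\beta$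 with each consecutive pair satisfying $\sim$ or $\equiv$. -}

module Defs where

open import Data.Nat using (ℕ; zero; suc; _+_; _≤_; _<_; s≤s)
open import Data.Nat.Properties using () renaming (_<?_ to _<ℕ?_)
open import Data.Fin using (Fin; zero; suc; toℕ; fromℕ<)
open import Data.Bool using (Bool; true; false)
open import Data.Product using (Σ; _×_; _,_; proj₁; ∃)
open import Data.Sum using (_⊎_)
open import Relation.Nullary using (¬_; yes; no)
open import Relation.Binary.PropositionalEquality using (_≡_; _≢_)
open import Relation.Binary.Construct.Closure.ReflexiveTransitive using (Star)
open import Relation.Binary.Construct.Closure.Transitive using (TransClosure)
open import Function.Bundles using (_↔_; Inverse)

record MultGraph : Set where
  field
    m     : ℕ
    adj   : Fin m → Fin m → Bool
    sym   : ∀ u v → adj u v ≡ adj v u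
    irrefl : ∀ v → adj v v ≡ false
    mult  : Fin m → ℕ
    mult-pos : ∀ v → 1 ≤ mult v

open MultGraph public

∑ : ∀ {m} → (Fin m → ℕ) → ℕ
∑ {zero} f = 0
∑ {suc m} f = f zero + ∑ (λ i → f (suc i))

totalMult : MultGraph → ℕ
totalMult X = ∑ (mult X)

Adj : (X : MultGraph) → Fin (m X) → Fin (m X) → Set
Adj X u v = adj X u v ≡ true

Connected : MultGraph → Set
Connected X = ∀ u v → Star (Adj X) u v

-- vertices of the lift X' : ⨆_v S_v with |S_v| = c_v
LiftV : MultGraph → Set
LiftV X = Σ (Fin (m X)) (λ v → Fin (mult X v))

proj : (X : MultGraph) → LiftV X → Fin (m X)
proj X = proj₁

LiftAdj : (X : MultGraph) → LiftV X → LiftV X → Set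
LiftAdj X (u , i) (v , j) = (Σ (u ≡ v) (λ _ → ¬ ((u , i) ≡ (v , j)))) ⊎ (u ≢ v × Adj X u v)

CompEdge : (X : MultGraph) → LiftV X → LiftV X → Set
CompEdge X x y = x ≢ y × ¬ LiftAdj X x y

-- an orientation is given by a Bool-valued relation: O x y ≡ true means x → y
Orient : MultGraph → Set
Orient X = LiftV X → LiftV X → Bool

Arc : (X : MultGraph) → Orient X → LiftV X → LiftV X → Set
Arc X O x y = O x y ≡ true

IsOrientation : (X : MultGraph) → Orient X → Set
IsOrientation X O =
  (∀ x y → Arc X O x y → CompEdge X x y) ×
  (∀ x y → CompEdge X x y → Arc X O x y ⊎ Arc X O y x) ×
  (∀ x y → Arc X O x y → ¬ Arc X O y x)

IsAcyclic : (X : MultGraph) → Orient X → Set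
IsAcyclic X O = ∀ x → ¬ TransClosure (Arc X O) x x

AcyclicOrientation : (X : MultGraph) → Orient X → Set
AcyclicOrientation X O = IsOrientation X O × IsAcyclic X O

-- σ is a linear extension of O: α_{X'-bar}(σ) = O
-- (positions are 0-indexed elements of Fin n)
IsLinExt : (X : MultGraph) → (n : ℕ) → Orient X → Fin n ↔ LiftV X → Set
IsLinExt X n O σ = ∀ x y →
  (Arc X O x y → CompEdge X x y × toℕ (Inverse.from σ x) < toℕ (Inverse.from σ y)) ×
  (CompEdge X x y × toℕ (Inverse.from σ x) < toℕ (Inverse.from σ y) → Arc X O x y)

-- the cyclic shift φ (0-indexed: k ↦ k+1 for k < n-1, n-1 ↦ 0)
φ : ∀ {n} → Fin n → Fin n
φ {suc k} i with toℕ i <ℕ? k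
... | yes p = fromℕ< (s≤s p)
... | no _ = zero

φ^ : ∀ {n} → ℕ → Fin n → Fin n
φ^ zero i = i
φ^ (suc t) i = φ (φ^ t i)

IsPeriodOf : (X : MultGraph) → (n : ℕ) → Fin n ↔ LiftV X → ℕ → Set
IsPeriodOf X n σ t = 1 ≤ t × (∀ k → proj X (Inverse.to σ (φ^ t k)) ≡ proj X (Inverse.to σ k))

PeriodOf : (X : MultGraph) → (n : ℕ) → Fin n ↔ LiftV X → ℕ → Set
PeriodOf X n σ t = IsPeriodOf X n σ t × (∀ s → IsPeriodOf X n σ s → t ≤ s)

OrientPeriod : (X : MultGraph) → (n : ℕ) → Orient X → ℕ → Set
OrientPeriod X n O t =
  (Σ (Fin n ↔ LiftV X) (λ σ → IsLinExt X n O σ × PeriodOf X n σ t)) ×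
  (∀ σ s → IsLinExt X n O σ → PeriodOf X n σ s → t ≤ s)

SymEquiv : (X : MultGraph) → Orient X → Orient X → Set
SymEquiv X α β = Σ (LiftV X ↔ LiftV X) (λ ρ →
  (∀ x → proj X (Inverse.to ρ x) ≡ proj X x) ×
  (∀ u v → α u v ≡ β (Inverse.to ρ u) (Inverse.to ρ v)))

IsSource IsSink : (X : MultGraph) → Orient X → LiftV X → Set
IsSource X O x = ∀ y → CompEdge X x y → Arc X O x y
IsSink X O x = ∀ y → CompEdge X x y → Arc X O y x

FlipStep : (X : MultGraph) → Orient X → Orient X → Set
FlipStep X α β = Σ (LiftV X) (λ x →
  (IsSource X α x ⊎ IsSink X α x) ×
  (∀ u v → (u ≡ x ⊎ v ≡ x) → β u v ≡ α v u) ×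
  (∀ u v → u ≢ x → v ≢ x → β u v ≡ α u v))

Toric : (X : MultGraph) → Orient X → Orient X → Set
Toric X = Star (FlipStep X)

ToricSymEquiv : (X : MultGraph) → Orient X → Orient X → Set
ToricSymEquiv X = Star (λ a b → Toric X a b ⊎ SymEquiv X a b)

-- A linear extension whose least period t divides n = Q t lists the same fibres, in the same
-- order, in each of its Q consecutive blocks of length t.  Such block-periodic extensions are
-- carried along every generating step of ≃ without changing t: along 𝔖_X by relabelling inside the
-- fibres; along a flip at a source x, which lies in the first block unless it has no neighbour in
-- the complement, by moving the offset of x to the front of every block and then rotating x from
-- the first to the last position; along a flip at a sink by reversing all orders.  So every period
-- of a linear extension of α bounds one of β from above and conversely, and the least periods agree.
module Submission where

open import Defs renaming (sym to adj-sym)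
open import Level using (0ℓ)
open import Data.Nat using (ℕ; zero; suc; _+_; _*_; _∸_; _≤_; _<_; z≤n; s≤s)
open import Data.Nat.Properties
open import Data.Nat.Tactic.RingSolver using (solve-∀)
open import Data.Nat.DivMod using (_%_; _/_; m≡m%n+[m/n]*n; m%n<n)
open import Data.Bool using (true)
import Data.Bool.Properties as Bool
open import Data.Fin using (Fin; zero; suc; toℕ; fromℕ<; combine; opposite; punchIn; punchOut)
open import Data.Fin.Properties
  using (toℕ-injective; toℕ<n; toℕ-fromℕ<; toℕ-↑ˡ; toℕ-↑ʳ; toℕ-combine; remQuot-combine; combine-monoˡ-<;
         combine-surjective; *↔×; +↔⊎; opposite-prop; opposite-involutive; punchIn-punchOut;
         punchIn-cancel-≤; pigeonhole; any?; all?)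
  renaming (_≟_ to _≟ᶠ_)
open import Data.Fin.Permutation using (Permutation; _⟨$⟩ʳ_; _⟨$⟩ˡ_; insert; insert-punchIn)
import Data.Fin.Permutation as Perm
open import Data.Vec.Functional using () renaming (_∷_ to _∷ᵛ_)
open import Data.Product using (Σ; ∃; _×_; _,_; proj₁; proj₂)
open import Data.Product.Properties using (≡-dec)
open import Data.Product.Function.NonDependent.Propositional using (_×-↔_)
open import Data.Sum using (_⊎_; inj₁; inj₂; [_,_]′; swap)
open import Data.Sum.Function.Propositional using (_⊎-↔_)
open import Data.Empty using (⊥; ⊥-elim)
open import Relation.Nullary using (¬_; Dec; yes; no)
open import Relation.Nullary.Decidable using (_×-dec_; _⊎-dec_; _→-dec_; ¬?; map′)
open import Relation.Binary using (Rel; Decidable; DecidableEquality; tri<; tri≈; tri>)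
open import Relation.Binary.PropositionalEquality
open import Relation.Binary.Construct.Closure.ReflexiveTransitive using (ε; _◅_)
import Relation.Binary.Construct.Closure.ReflexiveTransitive as Star
open import Relation.Binary.Construct.Closure.Transitive using (TransClosure; [_]; _∷_)
open import Function using (_∘_; case_of_)
open import Function.Bundles using (_↔_; Inverse; mk↔ₛ′)
open import Function.Properties.Inverse using (↔-refl)
open import Function.Construct.Composition using (_↔-∘_)
open import Function.Construct.Symmetry using (↔-sym)

from-injective : ∀ {A B : Set} (σ : A ↔ B) {a b} → Inverse.from σ a ≡ Inverse.from σ b → a ≡ b
from-injective σ {a} {b} e =
  trans (sym (Inverse.strictlyInverseˡ σ a)) (trans (cong (Inverse.to σ) e) (Inverse.strictlyInverseˡ σ b))

least-witness : {P : ℕ → Set} → (∀ s → Dec (P s)) → ∀ {b} → P b → Σ ℕ λ t → P t × (∀ s → P s → t ≤ s)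
least-witness {P} P? {b} pb = search b 0 refl (λ _ ())
  where
    search : ∀ fuel k → k + fuel ≡ b → (∀ s → s < k → ¬ P s) → Σ ℕ λ t → P t × (∀ s → P s → t ≤ s)
    search zero k k≡b none-below =
      k , subst P (trans (sym k≡b) (+-identityʳ k)) pb , λ s ps → ≮⇒≥ λ s<k → none-below s s<k ps
    search (suc fuel) k e none-below with P? k
    ... | yes pk = k , pk , λ s ps → ≮⇒≥ λ s<k → none-below s s<k ps
    ... | no ¬pk = search fuel (suc k) (trans (sym (+-suc k fuel)) e) none-to-k
      where
        none-to-k : ∀ s → s < suc k → ¬ P s
        none-to-k s s<k+1 with m<1+n⇒m<n∨m≡n s<k+1
        ... | inj₁ s<k  = none-below s s<k
        ... | inj₂ refl = ¬pk

∃-→? : ∀ {k l} {P : (Fin k → Fin l) → Set} → (∀ f → Dec (P f)) → (∀ {f g} → f ≗ g → P f → P g) → Dec (∃ P)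
∃-→? {zero} P? resp with P? (λ ())
... | yes p = yes (_ , p)
... | no ¬p = no λ (f , pf) → ¬p (resp (λ ()) pf)
∃-→? {suc k} {P = P} P? resp
  with any? (λ b → ∃-→? (λ h → P? (b ∷ᵛ h)) (λ h≗h′ → resp (λ { zero → refl ; (suc i) → h≗h′ i })))
... | yes (b , h , p) = yes (b ∷ᵛ h , p)
... | no ¬p = no λ (f , pf) → ¬p (f zero , f ∘ suc , resp (λ { zero → refl ; (suc i) → refl }) pf)

Σ-suc-↔ : ∀ {m} (B : Fin (suc m) → Set) → (B zero ⊎ Σ (Fin m) (B ∘ suc)) ↔ Σ (Fin (suc m)) B
Σ-suc-↔ {m} B = mk↔ₛ′ to from to-from from-to
  where
    to : B zero ⊎ Σ (Fin m) (B ∘ suc) → Σ (Fin (suc m)) B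
    to (inj₁ b)       = zero , b
    to (inj₂ (i , b)) = suc i , b
    from : Σ (Fin (suc m)) B → B zero ⊎ Σ (Fin m) (B ∘ suc)
    from (zero , b)  = inj₁ b
    from (suc i , b) = inj₂ (i , b)
    to-from : ∀ p → to (from p) ≡ p
    to-from (zero , b)  = refl
    to-from (suc i , b) = refl
    from-to : ∀ s → from (to s) ≡ s
    from-to (inj₁ b)       = refl
    from-to (inj₂ (i , b)) = refl

Fin-∑-↔ : ∀ {m} (f : Fin m → ℕ) → Fin (∑ f) ↔ Σ (Fin m) (Fin ∘ f)
Fin-∑-↔ {zero}  f = mk↔ₛ′ (λ ()) (λ ()) (λ ()) (λ ())
Fin-∑-↔ {suc m} f = Σ-suc-↔ (Fin ∘ f) ↔-∘ ((↔-refl ⊎-↔ Fin-∑-↔ (f ∘ suc)) ↔-∘ +↔⊎)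

Acyclic : ∀ {A : Set} → Rel A 0ℓ → Set
Acyclic R = ∀ a → ¬ TransClosure R a a

TransClosure-map : ∀ {A B : Set} {R : Rel A 0ℓ} {S : Rel B 0ℓ} (f : A → B) →
  (∀ {a b} → R a b → S (f a) (f b)) → ∀ {a b} → TransClosure R a b → TransClosure S (f a) (f b)
TransClosure-map f h [ r ]    = [ h r ]
TransClosure-map f h (r ∷ rs) = h r ∷ TransClosure-map f h rs

insert-self : ∀ {m n} (i : Fin (suc m)) (j : Fin (suc n)) (π : Permutation m n) → insert i j π ⟨$⟩ʳ i ≡ j
insert-self i j π with i ≟ᶠ i
... | yes _   = refl
... | no i≢i = ⊥-elim (i≢i refl)

module _ {N : ℕ} {R : Rel (Fin N) 0ℓ} (R? : Decidable R) (acyclic : Acyclic R) where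

  -- Without a source, walking backwards along R for N steps revisits a vertex, closing a cycle.
  private module Backwards (predecessor : ∀ s → Σ (Fin N) λ i → R i s) (start : Fin N) where

    walk : ℕ → Fin N
    walk zero    = start
    walk (suc k) = proj₁ (predecessor (walk k))

    descent : ∀ d k → TransClosure R (walk (suc d + k)) (walk k)
    descent zero    k = [ proj₂ (predecessor (walk k)) ]
    descent (suc d) k = proj₂ (predecessor (walk (suc d + k))) ∷ descent d k

    cycle : ∀ {a b} → a < b → walk a ≡ walk b → TransClosure R (walk a) (walk a)
    cycle {a} {b} a<b same = subst (λ v → TransClosure R v (walk a)) (trans (cong walk b≡) (sym same)) (descent d a)
      where
        d : ℕ
        d = b ∸ suc a
        b≡ : suc d + a ≡ b
        b≡ = trans (+-comm (suc d) a) (trans (+-suc a d) (m+[n∸m]≡n a<b))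

    impossible : ⊥
    impossible with pigeonhole (n<1+n N) (λ (k : Fin (suc N)) → walk (toℕ k))
    ... | _ , _ , i<j , same = acyclic _ (cycle i<j same)

  source-exists : Fin N → Σ (Fin N) λ s → ∀ i → ¬ R i s
  source-exists start with any? (λ s → all? (λ i → ¬? (R? i s)))
  ... | yes source   = source
  ... | no no-source = ⊥-elim (Backwards.impossible predecessor start)
    where
      predecessor : ∀ s → Σ (Fin N) λ i → R i s
      predecessor s with any? (λ i → R? i s)
      ... | yes p = p
      ... | no ¬p = ⊥-elim (no-source (s , λ i r → ¬p (i , r)))

topological-sort : ∀ {N} {R : Rel (Fin N) 0ℓ} → Decidable R → Acyclic R →
  Σ (Permutation N N) λ π → ∀ i j → R (π ⟨$⟩ʳ i) (π ⟨$⟩ʳ j) → toℕ i < toℕ j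
topological-sort {zero}  R? acyclic = Perm.id , λ ()
topological-sort {suc N} {R} R? acyclic with source-exists R? acyclic zero
... | s , source with topological-sort {R = λ a b → R (punchIn s a) (punchIn s b)}
                        (λ a b → R? (punchIn s a) (punchIn s b))
                        (λ a cycle → acyclic (punchIn s a) (TransClosure-map (punchIn s) (λ r → r) cycle))
... | π , sorted = insert zero s π , ordered
  where
    at-suc : ∀ k → insert zero s π ⟨$⟩ʳ suc k ≡ punchIn s (π ⟨$⟩ʳ k)
    at-suc = insert-punchIn zero s π
    ordered : ∀ i j → R (insert zero s π ⟨$⟩ʳ i) (insert zero s π ⟨$⟩ʳ j) → toℕ i < toℕ j
    ordered zero    zero    r = ⊥-elim (acyclic _ [ r ])
    ordered zero    (suc j) r = s≤s z≤n
    ordered (suc i) zero    r = ⊥-elim (source _ (subst (R _) (insert-self zero s π) r))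
    ordered (suc i) (suc j) r = s≤s (sorted i j (subst₂ R (at-suc i) (at-suc j) r))

-- The cyclic shift and blocks of positions

φ-cases : ∀ {n} (i : Fin n) →
  (suc (toℕ i) < n × toℕ (φ i) ≡ suc (toℕ i)) ⊎ (suc (toℕ i) ≡ n × toℕ (φ i) ≡ 0)
φ-cases {suc k} i with toℕ i <? k
... | yes i<k = inj₁ (s≤s i<k , toℕ-fromℕ< (s≤s i<k))
... | no  i≮k = inj₂ (cong suc (≤-antisym (≤-pred (toℕ<n i)) (≮⇒≥ i≮k)) , refl)

toℕ-φ-< : ∀ {n} (i : Fin n) → suc (toℕ i) < n → toℕ (φ i) ≡ suc (toℕ i)
toℕ-φ-< i lt with φ-cases i
... | inj₁ (_ , e) = e
... | inj₂ (e , _) = ⊥-elim (<-irrefl e lt)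

toℕ-φ-last : ∀ {n} (i : Fin n) → suc (toℕ i) ≡ n → toℕ (φ i) ≡ 0
toℕ-φ-last i e with φ-cases i
... | inj₁ (lt , _) = ⊥-elim (<-irrefl e lt)
... | inj₂ (_ , e′) = e′

φ^-+ : ∀ {n} a b (i : Fin n) → φ^ (a + b) i ≡ φ^ a (φ^ b i)
φ^-+ zero    b i = refl
φ^-+ (suc a) b i = cong φ (φ^-+ a b i)

toℕ-φ^ : ∀ {n} j (i : Fin n) → toℕ i + j < n → toℕ (φ^ j i) ≡ toℕ i + j
toℕ-φ^     zero    i _  = sym (+-identityʳ _)
toℕ-φ^ {n} (suc j) i lt = begin
  toℕ (φ (φ^ j i))    ≡⟨ toℕ-φ-< (φ^ j i) (subst (λ k → suc k < n) (sym ih) lt′) ⟩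
  suc (toℕ (φ^ j i))  ≡⟨ cong suc ih ⟩
  suc (toℕ i + j)     ≡⟨ +-suc (toℕ i) j ⟨
  toℕ i + suc j       ∎
  where
    open ≡-Reasoning
    lt′ : suc (toℕ i + j) < n
    lt′ = subst (_< n) (+-suc (toℕ i) j) lt
    ih : toℕ (φ^ j i) ≡ toℕ i + j
    ih = toℕ-φ^ j i (<-trans (n<1+n _) lt′)

-- Walk d steps to the last position, one more to 0, then toℕ i steps back to i.
φ^-cycle : ∀ {n} (i : Fin n) → φ^ n i ≡ i
φ^-cycle {n} i = begin
  φ^ n i                              ≡⟨ cong (λ k → φ^ k i) n≡i+1+d ⟩
  φ^ (toℕ i + suc d) i                ≡⟨ φ^-+ (toℕ i) (suc d) i ⟩
  φ^ (toℕ i) (φ (φ^ d i))             ≡⟨ toℕ-injective back ⟩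
  i                                   ∎
  where
    open ≡-Reasoning
    d : ℕ
    d = n ∸ suc (toℕ i)
    i+1+d≡n : suc (toℕ i) + d ≡ n
    i+1+d≡n = m+[n∸m]≡n (toℕ<n i)
    n≡i+1+d : n ≡ toℕ i + suc d
    n≡i+1+d = sym (trans (+-suc (toℕ i) d) i+1+d≡n)
    at0 : toℕ (φ (φ^ d i)) ≡ 0
    at0 = toℕ-φ-last (φ^ d i) (trans (cong suc (toℕ-φ^ d i (subst (toℕ i + d <_) i+1+d≡n ≤-refl))) i+1+d≡n)
    back : toℕ (φ^ (toℕ i) (φ (φ^ d i))) ≡ toℕ i
    back = trans (toℕ-φ^ (toℕ i) _ (subst (λ k → k + toℕ i < n) (sym at0) (toℕ<n i))) (cong (_+ toℕ i) at0)

rotate : ∀ {n} → Permutation (suc n) (suc n)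
rotate {n} = mk↔ₛ′ φ (φ^ n) φ^-cycle
  (λ i → trans (sym (φ^-+ n 1 i)) (trans (cong (λ k → φ^ k i) (+-comm n 1)) (φ^-cycle i)))

toℕ-combine-zero : ∀ {Q T} (r : Fin T) → toℕ (combine {suc Q} zero r) ≡ toℕ r
toℕ-combine-zero {Q} {T} r = toℕ-↑ˡ r (Q * T)

combine-monoʳ-< : ∀ {Q T} (q : Fin Q) {r r′ : Fin T} → toℕ r < toℕ r′ →
  toℕ (combine q r) < toℕ (combine q r′)
combine-monoʳ-< {T = T} q {r} {r′} lt =
  subst₂ _<_ (sym (toℕ-combine q r)) (sym (toℕ-combine q r′)) (+-monoʳ-< (T * toℕ q) lt)

combine-<-lex : ∀ {Q T} (q q′ : Fin Q) (r r′ : Fin T) → toℕ (combine q r) < toℕ (combine q′ r′) →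
  toℕ q < toℕ q′ ⊎ (q ≡ q′ × toℕ r < toℕ r′)
combine-<-lex {T = T} q q′ r r′ lt with <-cmp (toℕ q) (toℕ q′)
... | tri< q<q′ _ _ = inj₁ q<q′
... | tri≈ _ q≡q′ _ = inj₂ (toℕ-injective q≡q′ , +-cancelˡ-< (T * toℕ q) (toℕ r) (toℕ r′)
        (subst₂ _<_ (toℕ-combine q r) (trans (toℕ-combine q′ r′) (cong (λ k → T * k + toℕ r′) (sym q≡q′))) lt))
... | tri> _ _ q>q′ = ⊥-elim (<-asym lt (combine-monoˡ-< r′ r q>q′))

suc-combine : ∀ {Q T} (q : Fin Q) (r : Fin T) → suc (toℕ (combine q r)) ≡ T * toℕ q + suc (toℕ r)
suc-combine {T = T} q r = trans (cong suc (toℕ-combine q r)) (sym (+-suc (T * toℕ q) (toℕ r)))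

φ-combine : ∀ {Q T} (q : Fin Q) (r : Fin T) → Σ (Fin Q) λ q′ → φ (combine q r) ≡ combine q′ (φ r)
φ-combine {suc Q} {T} q r with φ-cases r | φ-cases (combine q r)
... | inj₁ (_ , φr) | inj₁ (_ , φc) = q , toℕ-injective (begin
  toℕ (φ (combine q r))       ≡⟨ trans φc (suc-combine q r) ⟩
  T * toℕ q + suc (toℕ r)     ≡⟨ cong (T * toℕ q +_) φr ⟨
  T * toℕ q + toℕ (φ r)       ≡⟨ toℕ-combine q (φ r) ⟨
  toℕ (combine q (φ r))       ∎)
  where open ≡-Reasoning
... | inj₁ (_ , φr) | inj₂ (last , _) = ⊥-elim (<-irrefl last (begin-strict
  suc (toℕ (combine q r))     ≡⟨ suc-combine q r ⟩
  T * toℕ q + suc (toℕ r)     ≡⟨ cong (T * toℕ q +_) φr ⟨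
  T * toℕ q + toℕ (φ r)       ≡⟨ toℕ-combine q (φ r) ⟨
  toℕ (combine q (φ r))       <⟨ toℕ<n (combine q (φ r)) ⟩
  suc Q * T                   ∎))
  where open ≤-Reasoning
... | inj₂ (r-last , φr) | inj₁ (c+1<n , φc) = fromℕ< q+1<Q , toℕ-injective (begin
  toℕ (φ (combine q r))                ≡⟨ trans φc c+1≡T*[q+1] ⟩
  T * suc (toℕ q)                      ≡⟨ +-identityʳ _ ⟨
  T * suc (toℕ q) + 0                  ≡⟨ cong₂ (λ a b → T * a + b) (toℕ-fromℕ< q+1<Q) φr ⟨
  T * toℕ (fromℕ< q+1<Q) + toℕ (φ r)   ≡⟨ toℕ-combine (fromℕ< q+1<Q) (φ r) ⟨
  toℕ (combine (fromℕ< q+1<Q) (φ r))   ∎)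
  where
    open ≡-Reasoning
    c+1≡T*[q+1] : suc (toℕ (combine q r)) ≡ T * suc (toℕ q)
    c+1≡T*[q+1] = trans (suc-combine q r)
                    (trans (cong (T * toℕ q +_) r-last) (trans (+-comm (T * toℕ q) T) (sym (*-suc T (toℕ q)))))
    q+1<Q : suc (toℕ q) < suc Q
    q+1<Q = *-cancelˡ-< T (suc (toℕ q)) (suc Q)
              (subst₂ _<_ c+1≡T*[q+1] (*-comm (suc Q) T) c+1<n)
... | inj₂ (_ , φr) | inj₂ (_ , φc) =
  zero , toℕ-injective (trans φc (sym (trans (toℕ-combine-zero {Q} (φ r)) φr)))

φ^-combine : ∀ {Q T} j (q : Fin Q) (r : Fin T) → Σ (Fin Q) λ q′ → φ^ j (combine q r) ≡ combine q′ (φ^ j r)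
φ^-combine zero    q r = q , refl
φ^-combine (suc j) q r with φ^-combine j q r
... | q₁ , e with φ-combine q₁ (φ^ j r)
...   | q₂ , e₂ = q₂ , trans (cong φ e) e₂

φ^-combine-period : ∀ {Q T} (q : Fin Q) (r : Fin T) → Σ (Fin Q) λ q′ → φ^ T (combine q r) ≡ combine q′ r
φ^-combine-period {T = T} q r with φ^-combine T q r
... | q′ , e = q′ , trans e (cong (combine q′) (φ^-cycle r))

φ^-combine-blocks : ∀ {Q T} d (q q′ : Fin Q) (r : Fin T) → toℕ q + d ≡ toℕ q′ →
  φ^ (d * T) (combine q r) ≡ combine q′ r
φ^-combine-blocks {Q} {T} d q q′ r q+d≡q′ =
  toℕ-injective (trans (toℕ-φ^ (d * T) (combine q r) (subst (_< Q * T) (sym shift) (toℕ<n (combine q′ r)))) shift)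
  where
    shift : toℕ (combine q r) + d * T ≡ toℕ (combine q′ r)
    shift = begin
      toℕ (combine q r) + d * T      ≡⟨ cong (_+ d * T) (toℕ-combine q r) ⟩
      T * toℕ q + toℕ r + d * T      ≡⟨ regroup T (toℕ q) (toℕ r) d ⟩
      T * (toℕ q + d) + toℕ r        ≡⟨ cong (λ k → T * k + toℕ r) q+d≡q′ ⟩
      T * toℕ q′ + toℕ r             ≡⟨ toℕ-combine q′ r ⟨
      toℕ (combine q′ r)             ∎
      where
        open ≡-Reasoning
        regroup : ∀ t a b c → t * a + b + c * t ≡ t * (a + c) + b
        regroup = solve-∀

opposite-< : ∀ {n} {i j : Fin n} → toℕ i < toℕ j → toℕ (opposite j) < toℕ (opposite i)
opposite-< {i = i} {j} lt rewrite opposite-prop i | opposite-prop j = ∸-monoʳ-< (s≤s lt) (toℕ<n j)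

opposite-cancel-< : ∀ {n} {i j : Fin n} → toℕ (opposite i) < toℕ (opposite j) → toℕ j < toℕ i
opposite-cancel-< {i = i} {j} lt =
  subst₂ (λ a b → toℕ a < toℕ b) (opposite-involutive j) (opposite-involutive i) (opposite-< lt)

opposite-combine : ∀ {Q T} (q : Fin Q) (r : Fin T) → opposite (combine q r) ≡ combine (opposite q) (opposite r)
opposite-combine {Q} {T} q r = toℕ-injective (begin
  toℕ (opposite (combine q r))   ≡⟨ opposite-prop (combine q r) ⟩
  Q * T ∸ suc c                  ≡⟨ cong (_∸ suc c) complement ⟨
  c′ + suc c ∸ suc c             ≡⟨ m+n∸n≡m c′ (suc c) ⟩
  c′                             ∎)
  where
    open ≡-Reasoning
    c c′ a b : ℕ
    c = toℕ (combine q r)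
    c′ = toℕ (combine (opposite q) (opposite r))
    a = toℕ (opposite q)
    b = toℕ (opposite r)
    Q≡ : suc (toℕ q) + a ≡ Q
    Q≡ = trans (cong (suc (toℕ q) +_) (opposite-prop q)) (m+[n∸m]≡n (toℕ<n q))
    T≡ : suc (toℕ r) + b ≡ T
    T≡ = trans (cong (suc (toℕ r) +_) (opposite-prop r)) (m+[n∸m]≡n (toℕ<n r))
    identity : ∀ x y z w → (suc z + w) * y + w + suc ((suc z + w) * x + z) ≡ (suc x + y) * (suc z + w)
    identity = solve-∀
    complement : c′ + suc c ≡ Q * T
    complement = trans (cong₂ (λ u v → u + suc v) (toℕ-combine (opposite q) (opposite r)) (toℕ-combine q r))
                   (subst₂ (λ t s → t * a + b + suc (t * toℕ q + toℕ r) ≡ s * t) T≡ Q≡ (identity (toℕ q) a (toℕ r) b))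

blockwise : ∀ {Q T} → Permutation T T → Permutation (Q * T) (Q * T)
blockwise {Q} π = ↔-sym (*↔× {Q}) ↔-∘ ((↔-refl ×-↔ π) ↔-∘ *↔× {Q})

blockwise-combine : ∀ {Q T} (π : Permutation T T) (q : Fin Q) (r : Fin T) →
  blockwise {Q} π ⟨$⟩ʳ combine q r ≡ combine q (π ⟨$⟩ʳ r)
blockwise-combine {Q} π q r = cong (λ p → combine (proj₁ p) (π ⟨$⟩ʳ proj₂ p)) (remQuot-combine {Q} q r)

blockwise-combine⁻¹ : ∀ {Q T} (π : Permutation T T) (q : Fin Q) (r : Fin T) →
  blockwise {Q} π ⟨$⟩ˡ combine q r ≡ combine q (π ⟨$⟩ˡ r)
blockwise-combine⁻¹ {Q} π q r = cong (λ p → combine (proj₁ p) (π ⟨$⟩ˡ proj₂ p)) (remQuot-combine {Q} q r)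

-- i ↦ 0; the positions before i move up by one, those after i stay.
moveToFront : ∀ {n} → Fin (suc n) → Permutation (suc n) (suc n)
moveToFront i = insert i zero Perm.id

moveToFront-self : ∀ {n} (i : Fin (suc n)) → moveToFront i ⟨$⟩ʳ i ≡ zero
moveToFront-self i = insert-self i zero Perm.id

toℕ-moveToFront-≢ : ∀ {n} (i : Fin (suc n)) {c} (c≢i : c ≢ i) →
  toℕ (moveToFront i ⟨$⟩ʳ c) ≡ suc (toℕ (punchOut (c≢i ∘ sym)))
toℕ-moveToFront-≢ i c≢i = cong toℕ (trans (cong (moveToFront i ⟨$⟩ʳ_) (sym (punchIn-punchOut (c≢i ∘ sym))))
                                         (insert-punchIn i zero Perm.id _))

moveToFront-mono : ∀ {n} (i : Fin (suc n)) {a b : Fin (suc n)} → toℕ a < toℕ b → b ≢ i →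
  toℕ (moveToFront i ⟨$⟩ʳ a) < toℕ (moveToFront i ⟨$⟩ʳ b)
moveToFront-mono i {a} {b} a<b b≢i with a ≟ᶠ i
... | yes refl = subst₂ _<_ (sym (cong toℕ (moveToFront-self i))) (sym (toℕ-moveToFront-≢ i b≢i)) (s≤s z≤n)
... | no a≢i   = subst₂ _<_ (sym (toℕ-moveToFront-≢ i a≢i)) (sym (toℕ-moveToFront-≢ i b≢i))
                   (s≤s (≤∧≢⇒< ka≤kb (λ ka≡kb → <-irrefl (cong toℕ (a≡ ka≡kb)) a<b)))
  where
    ka = punchOut (a≢i ∘ sym)
    kb = punchOut (b≢i ∘ sym)
    a≡ : toℕ ka ≡ toℕ kb → a ≡ b
    a≡ e = trans (sym (punchIn-punchOut (a≢i ∘ sym)))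
             (trans (cong (punchIn i) (toℕ-injective e)) (punchIn-punchOut (b≢i ∘ sym)))
    ka≤kb : toℕ ka ≤ toℕ kb
    ka≤kb = punchIn-cancel-≤ i ka kb
              (subst₂ (λ x y → toℕ x ≤ toℕ y) (sym (punchIn-punchOut (a≢i ∘ sym))) (sym (punchIn-punchOut (b≢i ∘ sym)))
                      (<⇒≤ a<b))

module _ (X : MultGraph) where

  -- Periods of bijections onto the lift

  fibreAt : ∀ {n} → Fin n ↔ LiftV X → Fin n → Fin (m X)
  fibreAt σ k = proj X (Inverse.to σ k)

  IsPeriodOf-* : ∀ {n} (σ : Fin n ↔ LiftV X) {t} → IsPeriodOf X n σ t →
    ∀ j k → fibreAt σ (φ^ (j * t) k) ≡ fibreAt σ k
  IsPeriodOf-* σ     _                   zero    k = refl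
  IsPeriodOf-* σ {t} t-period@(_ , shift) (suc j) k =
    trans (cong (fibreAt σ) (φ^-+ t (j * t) k)) (trans (shift _) (IsPeriodOf-* σ t-period j k))

  IsPeriodOf? : ∀ {n} (σ : Fin n ↔ LiftV X) t → Dec (IsPeriodOf X n σ t)
  IsPeriodOf? σ t = (1 ≤? t) ×-dec all? (λ k → fibreAt σ (φ^ t k) ≟ᶠ fibreAt σ k)

  period-exists : ∀ {n} (σ : Fin n ↔ LiftV X) → Σ ℕ (IsPeriodOf X n σ)
  period-exists {zero}  σ = 1 , s≤s z≤n , λ ()
  period-exists {suc n} σ = suc n , s≤s z≤n , λ k → cong (fibreAt σ) (φ^-cycle k)

  least-period : ∀ {n} (σ : Fin n ↔ LiftV X) {s} → IsPeriodOf X n σ s → Σ ℕ λ t → t ≤ s × PeriodOf X n σ t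
  least-period σ {s} s-period with least-witness (IsPeriodOf? σ) s-period
  ... | t , t-period , least = t , least s s-period , t-period , least

  -- The remainder of n modulo the least period t would be a smaller period.
  least-period-divides : ∀ {n} (σ : Fin n ↔ LiftV X) {t} → PeriodOf X n σ t → Σ ℕ λ Q → Q * t ≡ n
  least-period-divides {zero}  σ _ = 0 , refl
  least-period-divides {suc n} σ {suc t} (t-period , least) with suc n % suc t ≟ 0
  ... | yes r≡0 = suc n / suc t , sym (trans (m≡m%n+[m/n]*n (suc n) (suc t)) (cong (_+ (suc n / suc t) * suc t) r≡0))
  ... | no  r≢0 = ⊥-elim (<⇒≱ (m%n<n (suc n) (suc t)) (least r (n≢0⇒n>0 r≢0 , r-shift)))
    where
      r Q : ℕ
      r = suc n % suc t
      Q = suc n / suc t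
      Qt+r≡n : Q * suc t + r ≡ suc n
      Qt+r≡n = trans (+-comm (Q * suc t) r) (sym (m≡m%n+[m/n]*n (suc n) (suc t)))
      r-shift : ∀ k → fibreAt σ (φ^ r k) ≡ fibreAt σ k
      r-shift k = begin
        fibreAt σ (φ^ r k)                   ≡⟨ IsPeriodOf-* σ t-period Q (φ^ r k) ⟨
        fibreAt σ (φ^ (Q * suc t) (φ^ r k))  ≡⟨ cong (fibreAt σ) (φ^-+ (Q * suc t) r k) ⟨
        fibreAt σ (φ^ (Q * suc t + r) k)     ≡⟨ cong (λ j → fibreAt σ (φ^ j k)) Qt+r≡n ⟩
        fibreAt σ (φ^ (suc n) k)             ≡⟨ cong (fibreAt σ) (φ^-cycle k) ⟩
        fibreAt σ k                          ∎
        where open ≡-Reasoning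

  BlockConstant : ∀ Q t → Fin (Q * t) ↔ LiftV X → Set
  BlockConstant Q t σ = ∀ (q q′ : Fin Q) (r : Fin t) → fibreAt σ (combine q r) ≡ fibreAt σ (combine q′ r)

  IsPeriodOf-combine-≤ : ∀ {Q t} (σ : Fin (Q * t) ↔ LiftV X) → IsPeriodOf X (Q * t) σ t →
    ∀ (q q′ : Fin Q) r → toℕ q ≤ toℕ q′ → fibreAt σ (combine q r) ≡ fibreAt σ (combine q′ r)
  IsPeriodOf-combine-≤ σ t-period q q′ r q≤q′ =
    trans (sym (IsPeriodOf-* σ t-period (toℕ q′ ∸ toℕ q) (combine q r)))
          (cong (fibreAt σ) (φ^-combine-blocks (toℕ q′ ∸ toℕ q) q q′ r (m+[n∸m]≡n q≤q′)))

  IsPeriodOf⇒BlockConstant : ∀ {Q t} (σ : Fin (Q * t) ↔ LiftV X) → IsPeriodOf X (Q * t) σ t → BlockConstant Q t σ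
  IsPeriodOf⇒BlockConstant σ t-period q q′ r with ≤-total (toℕ q) (toℕ q′)
  ... | inj₁ q≤q′ = IsPeriodOf-combine-≤ σ t-period q q′ r q≤q′
  ... | inj₂ q′≤q = sym (IsPeriodOf-combine-≤ σ t-period q′ q r q′≤q)

  BlockConstant⇒IsPeriodOf : ∀ {Q t} (σ : Fin (Q * t) ↔ LiftV X) → 1 ≤ t → BlockConstant Q t σ →
    IsPeriodOf X (Q * t) σ t
  BlockConstant⇒IsPeriodOf {Q} {t} σ 1≤t constant = 1≤t , shift
    where
      shift : ∀ k → fibreAt σ (φ^ t k) ≡ fibreAt σ k
      shift k with combine-surjective {Q} {t} k
      ... | q , r , refl with φ^-combine-period q r
      ...   | q′ , e = trans (cong (fibreAt σ) e) (constant q′ q r)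

  -- The complement of the lift and its linear extensions

  _≟ᴸ_ : DecidableEquality (LiftV X)
  _≟ᴸ_ = ≡-dec _≟ᶠ_ _≟ᶠ_

  LiftAdj-sym : ∀ {a b} → LiftAdj X a b → LiftAdj X b a
  LiftAdj-sym (inj₁ (u≡v , a≢b))  = inj₁ (sym u≡v , a≢b ∘ sym)
  LiftAdj-sym {u , _} {v , _} (inj₂ (u≢v , uv)) = inj₂ (u≢v ∘ sym , trans (adj-sym X v u) uv)

  CompEdge-sym : ∀ {a b} → CompEdge X a b → CompEdge X b a
  CompEdge-sym (a≢b , ¬ab) = a≢b ∘ sym , ¬ab ∘ LiftAdj-sym

  CompEdge-fibre : ∀ {a b a′ b′} → CompEdge X a b → proj X a′ ≡ proj X a → proj X b′ ≡ proj X b →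
    a′ ≢ b′ → CompEdge X a′ b′
  CompEdge-fibre {u , i} {v , j} {.u , i′} {.v , j′} (a≢b , ¬ab) refl refl a′≢b′ = a′≢b′ , ¬a′b′
    where
      ¬a′b′ : ¬ LiftAdj X (u , i′) (v , j′)
      ¬a′b′ (inj₁ (refl , _)) = ¬ab (inj₁ (refl , a≢b))
      ¬a′b′ (inj₂ u≢v,uv)     = ¬ab (inj₂ u≢v,uv)

  LiftAdj? : ∀ a b → Dec (LiftAdj X a b)
  LiftAdj? (u , i) (v , j) = same-fibre? ⊎-dec (¬? (u ≟ᶠ v) ×-dec (adj X u v Bool.≟ true))
    where
      same-fibre? : Dec (Σ (u ≡ v) λ _ → (u , i) ≢ (v , j))
      same-fibre? with u ≟ᶠ v
      ... | no u≢v = no (u≢v ∘ proj₁)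
      ... | yes refl = map′ (refl ,_) proj₂ (¬? ((u , i) ≟ᴸ (v , j)))

  CompEdge? : ∀ a b → Dec (CompEdge X a b)
  CompEdge? a b = ¬? (a ≟ᴸ b) ×-dec ¬? (LiftAdj? a b)

  position : ∀ {n} → Fin n ↔ LiftV X → LiftV X → ℕ
  position σ a = toℕ (Inverse.from σ a)

  IsLinExt-reorder : ∀ {n O} {σ τ : Fin n ↔ LiftV X} → IsLinExt X n O σ →
    (∀ {u v} → CompEdge X u v → position σ u < position σ v → position τ u < position τ v) →
    IsLinExt X n O τ
  IsLinExt-reorder {σ = σ} {τ} σ-ext mono u v =
      (λ uv → let ce , lt = proj₁ (σ-ext u v) uv in ce , mono ce lt)
    , (λ (ce , lt) → proj₂ (σ-ext u v) (ce , reflect ce lt))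
    where
      reflect : CompEdge X u v → position τ u < position τ v → position σ u < position σ v
      reflect ce τ-lt with <-cmp (position σ u) (position σ v)
      ... | tri< lt _ _ = lt
      ... | tri≈ _ eq _ = ⊥-elim (proj₁ ce (from-injective σ (toℕ-injective eq)))
      ... | tri> _ _ gt = ⊥-elim (<-asym τ-lt (mono (CompEdge-sym ce) gt))

  linear-extension-exists : ∀ {α} → AcyclicOrientation X α →
    Σ (Fin (totalMult X) ↔ LiftV X) (IsLinExt X (totalMult X) α)
  linear-extension-exists {α} ((arcs-are-edges , edges-are-arcs , _) , acyclic) = σ , extends
    where
      e : Fin (totalMult X) ↔ LiftV X
      e = Fin-∑-↔ (mult X)
      sorted : Σ (Permutation (totalMult X) (totalMult X)) λ π →
                 ∀ i j → Arc X α (Inverse.to e (π ⟨$⟩ʳ i)) (Inverse.to e (π ⟨$⟩ʳ j)) → toℕ i < toℕ j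
      sorted = topological-sort (λ i j → α (Inverse.to e i) (Inverse.to e j) Bool.≟ true)
                 (λ i cycle → acyclic _ (TransClosure-map (Inverse.to e) (λ r → r) cycle))
      σ : Fin (totalMult X) ↔ LiftV X
      σ = e ↔-∘ proj₁ sorted
      before : ∀ {a b} → Arc X α a b → position σ a < position σ b
      before {a} {b} ab = proj₂ sorted _ _
        (subst₂ (Arc X α) (sym (Inverse.strictlyInverseˡ σ a)) (sym (Inverse.strictlyInverseˡ σ b)) ab)
      extends : IsLinExt X (totalMult X) α σ
      extends a b = (λ ab → arcs-are-edges a b ab , before ab)
                  , λ (ce , lt) → [ (λ ab → ab) , (λ ba → ⊥-elim (<-asym lt (before ba))) ]′ (edges-are-arcs a b ce)

  PeriodicLinExt : ℕ → Orient X → ℕ → Set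
  PeriodicLinExt n O s = Σ (Fin n ↔ LiftV X) λ σ → IsLinExt X n O σ × IsPeriodOf X n σ s

  -- IsLinExt X n O σ and IsPeriodOf X n σ t are these, applied to Inverse.from σ and Inverse.to σ.
  OrdersArcs : ∀ {n} → Orient X → (LiftV X → Fin n) → Set
  OrdersArcs O pos = ∀ x y →
    (Arc X O x y → CompEdge X x y × toℕ (pos x) < toℕ (pos y)) ×
    (CompEdge X x y × toℕ (pos x) < toℕ (pos y) → Arc X O x y)

  FibrePeriodic : ∀ {n} → (Fin n → LiftV X) → ℕ → Set
  FibrePeriodic f t = 1 ≤ t × (∀ k → proj X (f (φ^ t k)) ≡ proj X (f k))

  all-LiftV? : {P : LiftV X → Set} → (∀ a → Dec (P a)) → Dec (∀ a → P a)
  all-LiftV? P? = map′ (λ h (v , i) → h v i) (λ h v i → h (v , i)) (all? λ v → all? λ i → P? (v , i))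

  OrdersArcs? : ∀ {n} O (pos : LiftV X → Fin n) → Dec (OrdersArcs O pos)
  OrdersArcs? O pos = all-LiftV? λ x → all-LiftV? λ y →
    let ordered? = CompEdge? x y ×-dec (toℕ (pos x) <? toℕ (pos y)) in
    ((O x y Bool.≟ true) →-dec ordered?) ×-dec (ordered? →-dec (O x y Bool.≟ true))

  FibrePeriodic? : ∀ {n} (f : Fin n → LiftV X) t → Dec (FibrePeriodic f t)
  FibrePeriodic? f t = (1 ≤? t) ×-dec all? (λ k → proj X (f (φ^ t k)) ≟ᶠ proj X (f k))

  OrdersArcs-cong : ∀ {n O} {pos pos′ : LiftV X → Fin n} → pos ≗ pos′ → OrdersArcs O pos → OrdersArcs O pos′
  OrdersArcs-cong {O = O} pos≗ ordered x y =
    subst₂ (λ p q → (Arc X O x y → CompEdge X x y × toℕ p < toℕ q) × (CompEdge X x y × toℕ p < toℕ q → Arc X O x y))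
           (pos≗ x) (pos≗ y) (ordered x y)

  FibrePeriodic-cong : ∀ {n t} {f f′ : Fin n → LiftV X} → f ≗ f′ → FibrePeriodic f t → FibrePeriodic f′ t
  FibrePeriodic-cong {t = t} f≗ (1≤t , shift) =
    1≤t , λ k → trans (cong (proj X) (sym (f≗ (φ^ t k)))) (trans (shift k) (cong (proj X) (f≗ k)))

  -- Bijections Fin n ↔ LiftV X are searched for as pairs of maps through the enumeration of LiftV X.
  PeriodicLinExt? : ∀ n O s → Dec (PeriodicLinExt n O s)
  PeriodicLinExt? n O s = map′ from-maps to-maps
    (∃-→? (λ f → ∃-→? (λ g → Witness? f g) (λ g≗ → Witness-congʳ g≗)) (λ f≗ (g , w) → g , Witness-congˡ f≗ w))
    where
      N : ℕ
      N = totalMult X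
      e : Fin N ↔ LiftV X
      e = Fin-∑-↔ (mult X)
      Witness : (Fin n → Fin N) → (Fin N → Fin n) → Set
      Witness f g = (∀ i → f (g i) ≡ i) × (∀ k → g (f k) ≡ k) ×
                    OrdersArcs O (g ∘ Inverse.from e) × FibrePeriodic (Inverse.to e ∘ f) s
      Witness? : ∀ f g → Dec (Witness f g)
      Witness? f g = all? (λ i → f (g i) ≟ᶠ i) ×-dec all? (λ k → g (f k) ≟ᶠ k) ×-dec
                     OrdersArcs? O (g ∘ Inverse.from e) ×-dec FibrePeriodic? (Inverse.to e ∘ f) s
      Witness-congˡ : ∀ {f f′ g} → f ≗ f′ → Witness f g → Witness f′ g
      Witness-congˡ {g = g} f≗ (fg , gf , ordered , periodic) =
        (λ i → trans (sym (f≗ (g i))) (fg i)) , (λ k → trans (cong g (sym (f≗ k))) (gf k)) ,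
        ordered , FibrePeriodic-cong (cong (Inverse.to e) ∘ f≗) periodic
      Witness-congʳ : ∀ {f g g′} → g ≗ g′ → Witness f g → Witness f g′
      Witness-congʳ {f} g≗ (fg , gf , ordered , periodic) =
        (λ i → trans (cong f (sym (g≗ i))) (fg i)) , (λ k → trans (sym (g≗ (f k))) (gf k)) ,
        OrdersArcs-cong (g≗ ∘ Inverse.from e) ordered , periodic
      from-maps : (∃ λ f → ∃ λ g → Witness f g) → PeriodicLinExt n O s
      from-maps (f , g , fg , gf , ordered , periodic) = e ↔-∘ mk↔ₛ′ f g fg gf , ordered , periodic
      to-maps : PeriodicLinExt n O s → ∃ λ f → ∃ λ g → Witness f g
      to-maps (σ , extends , periodic) =
        Inverse.from e ∘ Inverse.to σ , Inverse.from σ ∘ Inverse.to e ,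
        (λ i → trans (cong (Inverse.from e) (Inverse.strictlyInverseˡ σ _)) (Inverse.strictlyInverseʳ e i)) ,
        (λ k → trans (cong (Inverse.from σ) (Inverse.strictlyInverseˡ e _)) (Inverse.strictlyInverseʳ σ k)) ,
        OrdersArcs-cong (λ a → sym (cong (Inverse.from σ) (Inverse.strictlyInverseˡ e a))) extends ,
        FibrePeriodic-cong (λ k → sym (Inverse.strictlyInverseˡ e _)) periodic

  -- Transport of block-periodic linear extensions along ≃

  BlockExt : Orient X → ℕ → ℕ → Set
  BlockExt O Q t = Σ (Fin (Q * t) ↔ LiftV X) λ σ → IsLinExt X (Q * t) O σ × BlockConstant Q t σ

  _ᵒᵖ : Orient X → Orient X
  (O ᵒᵖ) u v = O v u

  BlockExt-ᵒᵖ : ∀ {O Q t} → BlockExt O Q t → BlockExt (O ᵒᵖ) Q t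
  BlockExt-ᵒᵖ {O} {Q} {t} (σ , extends , constant) = τ , τ-extends , τ-constant
    where
      τ : Fin (Q * t) ↔ LiftV X
      τ = σ ↔-∘ Perm.reverse
      τ-extends : IsLinExt X (Q * t) (O ᵒᵖ) τ
      τ-extends u v = (λ vu → let ce , lt = proj₁ (extends v u) vu in CompEdge-sym ce , opposite-< lt)
                    , λ (ce , lt) → proj₂ (extends v u) (CompEdge-sym ce , opposite-cancel-< lt)
      τ-constant : BlockConstant Q t τ
      τ-constant q q′ r = begin
        fibreAt σ (opposite (combine q r))                ≡⟨ cong (fibreAt σ) (opposite-combine q r) ⟩
        fibreAt σ (combine (opposite q) (opposite r))     ≡⟨ constant (opposite q) (opposite q′) (opposite r) ⟩
        fibreAt σ (combine (opposite q′) (opposite r))    ≡⟨ cong (fibreAt σ) (opposite-combine q′ r) ⟨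
        fibreAt σ (opposite (combine q′ r))               ∎
        where open ≡-Reasoning

  SymEquiv-sym : ∀ {α β} → SymEquiv X α β → SymEquiv X β α
  SymEquiv-sym {α} {β} (ρ , fibrewise , α≡β∘ρ) = ↔-sym ρ , fibrewise⁻¹ , β≡α∘ρ⁻¹
    where
      ρ⁻¹ : LiftV X → LiftV X
      ρ⁻¹ = Inverse.from ρ
      fibrewise⁻¹ : ∀ a → proj X (ρ⁻¹ a) ≡ proj X a
      fibrewise⁻¹ a = trans (sym (fibrewise (ρ⁻¹ a))) (cong (proj X) (Inverse.strictlyInverseˡ ρ a))
      β≡α∘ρ⁻¹ : ∀ u v → β u v ≡ α (ρ⁻¹ u) (ρ⁻¹ v)
      β≡α∘ρ⁻¹ u v = sym (trans (α≡β∘ρ (ρ⁻¹ u) (ρ⁻¹ v))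
                               (cong₂ β (Inverse.strictlyInverseˡ ρ u) (Inverse.strictlyInverseˡ ρ v)))

  BlockExt-SymEquiv : ∀ {α β Q t} → SymEquiv X α β → BlockExt α Q t → BlockExt β Q t
  BlockExt-SymEquiv {α} {β} {Q} {t} equiv@(ρ , fibrewise , _) (σ , extends , constant) =
    ρ ↔-∘ σ , τ-extends , τ-constant
    where
      ρ⁻¹ : LiftV X → LiftV X
      ρ⁻¹ = Inverse.from ρ
      fibrewise⁻¹ : ∀ a → proj X (ρ⁻¹ a) ≡ proj X a
      fibrewise⁻¹ = proj₁ (proj₂ (SymEquiv-sym {α} {β} equiv))
      β≡α∘ρ⁻¹ : ∀ u v → β u v ≡ α (ρ⁻¹ u) (ρ⁻¹ v)
      β≡α∘ρ⁻¹ = proj₂ (proj₂ (SymEquiv-sym {α} {β} equiv))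
      τ-extends : IsLinExt X (Q * t) β (ρ ↔-∘ σ)
      τ-extends u v =
          (λ uv → let ce , lt = proj₁ (extends (ρ⁻¹ u) (ρ⁻¹ v)) (trans (sym (β≡α∘ρ⁻¹ u v)) uv)
                  in CompEdge-fibre ce (sym (fibrewise⁻¹ u)) (sym (fibrewise⁻¹ v)) (proj₁ ce ∘ cong ρ⁻¹) , lt)
        , λ (ce , lt) → trans (β≡α∘ρ⁻¹ u v) (proj₂ (extends (ρ⁻¹ u) (ρ⁻¹ v))
                          (CompEdge-fibre ce (fibrewise⁻¹ u) (fibrewise⁻¹ v) (proj₁ ce ∘ from-injective ρ) , lt))
      τ-constant : BlockConstant Q t (ρ ↔-∘ σ)
      τ-constant q q′ r = trans (fibrewise _) (trans (constant q q′ r) (sym (fibrewise _)))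

  FlipsAt : Orient X → Orient X → LiftV X → Set
  FlipsAt α β x = (∀ u v → (u ≡ x ⊎ v ≡ x) → β u v ≡ α v u) × (∀ u v → u ≢ x → v ≢ x → β u v ≡ α u v)

  source-precedes : ∀ {n α x} {σ : Fin n ↔ LiftV X} → IsSource X α x → IsLinExt X n α σ →
    ∀ {a b z} → CompEdge X a b → proj X x ≡ proj X a → proj X z ≡ proj X b → z ≢ x →
    position σ x < position σ z
  source-precedes {x = x} source extends {z = z} ce x~a z~b z≢x =
    proj₂ (proj₁ (extends x z) (source z (CompEdge-fibre ce x~a z~b (z≢x ∘ sym))))

  position-to : ∀ {n} (σ : Fin n ↔ LiftV X) k → position σ (Inverse.to σ k) ≡ toℕ k
  position-to σ k = cong toℕ (Inverse.strictlyInverseʳ σ k)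

  fibreAt-from : ∀ {n} (σ : Fin n ↔ LiftV X) a → fibreAt σ (Inverse.from σ a) ≡ proj X a
  fibreAt-from σ a = cong (proj X) (Inverse.strictlyInverseˡ σ a)

  position-first-block : ∀ {Q t} (σ : Fin (suc Q * t) ↔ LiftV X) r →
    position σ (Inverse.to σ (combine {suc Q} zero r)) < t
  position-first-block {Q} {t} σ r = subst (_< t) (sym (trans (position-to σ (combine {suc Q} zero r)) (toℕ-combine-zero {Q} r))) (toℕ<n r)

  -- The neighbour y has a copy z in the first block; the source precedes z or is z.
  source-in-first-block : ∀ {α x Q t} {σ : Fin (suc Q * t) ↔ LiftV X} → IsSource X α x →
    IsLinExt X (suc Q * t) α σ → BlockConstant (suc Q) t σ → ∀ {y} → CompEdge X x y → position σ x < t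
  source-in-first-block {x = x} {Q} {t} {σ} source extends constant {y} ce
    with combine-surjective {suc Q} {t} (Inverse.from σ y)
  ... | q , r , at-y with Inverse.to σ (combine {suc Q} zero r) ≟ᴸ x
  ...   | yes z≡x = subst (λ a → position σ a < t) z≡x (position-first-block {Q} σ r)
  ...   | no  z≢x = <-trans (source-precedes {σ = σ} source extends ce refl z~y z≢x) (position-first-block {Q} σ r)
    where
      z~y : fibreAt σ (combine {suc Q} zero r) ≡ proj X y
      z~y = trans (constant zero q r) (trans (cong (fibreAt σ) at-y) (fibreAt-from σ y))

  position-rotate : ∀ {n} (σ : Fin (suc n) ↔ LiftV X) a →
    (position σ a ≡ 0 × position (σ ↔-∘ rotate) a ≡ n) ⊎ position σ a ≡ suc (position (σ ↔-∘ rotate) a)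
  position-rotate {n} σ a =
    [ (λ (_ , next) → inj₂ (trans unrotate next)) , (λ (last , at-0) → inj₁ (trans unrotate at-0 , suc-injective last)) ]′
    (φ-cases (Inverse.from (σ ↔-∘ rotate) a))
    where
      unrotate : position σ a ≡ toℕ (φ (Inverse.from (σ ↔-∘ rotate) a))
      unrotate = cong toℕ (sym (φ^-cycle (Inverse.from σ a)))

  IsLinExt-rotateSource : ∀ {n α β x} {σ : Fin (suc n) ↔ LiftV X} → IsSource X α x → FlipsAt α β x →
    IsLinExt X (suc n) α σ → Inverse.from σ x ≡ zero → IsLinExt X (suc n) β (σ ↔-∘ rotate)
  IsLinExt-rotateSource {n} {α} {β} {x} {σ} source (flip-x , flip-other) extends x-first = τ-extends
    where
      τ : Fin (suc n) ↔ LiftV X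
      τ = σ ↔-∘ rotate
      x-last : position τ x ≡ n
      x-last with position-rotate σ x
      ... | inj₁ (_ , last) = last
      ... | inj₂ e = ⊥-elim (0≢1+n (trans (sym (cong toℕ x-first)) e))
      shifted : ∀ {y} → y ≢ x → position σ y ≡ suc (position τ y)
      shifted {y} y≢x with position-rotate σ y
      ... | inj₂ e = e
      ... | inj₁ (first , _) = ⊥-elim (y≢x (from-injective σ (toℕ-injective (trans first (sym (cong toℕ x-first))))))
      τ-extends : IsLinExt X (suc n) β τ
      τ-extends u v with u ≟ᴸ x | v ≟ᴸ x
      ... | yes refl | _ =
          (λ xv → ⊥-elim (n≮0 (subst (position σ v <_) (cong toℕ x-first)
                    (proj₂ (proj₁ (extends v x) (trans (sym (flip-x x v (inj₁ refl))) xv))))))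
        , λ (_ , lt) → ⊥-elim (<⇒≱ lt (subst (position τ v ≤_) (sym x-last) (≤-pred (toℕ<n (Inverse.from τ v)))))
      ... | no u≢x | yes refl =
          (λ ux → CompEdge-sym (proj₁ (proj₁ (extends x u) (trans (sym (flip-x u x (inj₂ refl))) ux))) ,
                  subst (position τ u <_) (sym x-last)
                    (≤∧≢⇒< (≤-pred (toℕ<n (Inverse.from τ u)))
                           (λ e → u≢x (from-injective τ (toℕ-injective (trans e (sym x-last)))))))
        , λ (ce , _) → trans (flip-x u x (inj₂ refl)) (source u (CompEdge-sym ce))
      ... | no u≢x | no v≢x =
          (λ uv → let ce , lt = proj₁ (extends u v) (trans (sym (flip-other u v u≢x v≢x)) uv)
                  in ce , ≤-pred (subst₂ _<_ (shifted u≢x) (shifted v≢x) lt))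
        , λ (ce , lt) → trans (flip-other u v u≢x v≢x)
                          (proj₂ (extends u v) (ce , subst₂ _<_ (sym (shifted u≢x)) (sym (shifted v≢x)) (s≤s lt)))

  IsLinExt-flipIsolated : ∀ {n α β x} {σ : Fin n ↔ LiftV X} → FlipsAt α β x → (∀ y → ¬ CompEdge X x y) →
    IsLinExt X n α σ → IsLinExt X n β σ
  IsLinExt-flipIsolated {α = α} {β} {x} (flip-x , flip-other) isolated extends u v =
      (λ uv → proj₁ (extends u v) (trans (sym (β≡α u v)) uv))
    , λ c → trans (β≡α u v) (proj₂ (extends u v) c)
    where
      no-arc : ∀ a b → (a ≡ x ⊎ b ≡ x) → α a b ≢ true
      no-arc a b (inj₁ refl) ab = isolated b (proj₁ (proj₁ (extends a b) ab))
      no-arc a b (inj₂ refl) ab = isolated a (CompEdge-sym (proj₁ (proj₁ (extends a b) ab)))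
      β≡α : ∀ a b → β a b ≡ α a b
      β≡α a b with (a ≟ᴸ x) ⊎-dec (b ≟ᴸ x)
      ... | yes at-x = trans (flip-x a b at-x)
                         (trans (Bool.¬-not (no-arc b a (swap at-x))) (sym (Bool.¬-not (no-arc a b at-x))))
      ... | no ¬at-x = flip-other a b (¬at-x ∘ inj₁) (¬at-x ∘ inj₂)

  module _ {Q t : ℕ} where

    private
      N : ℕ
      N = suc Q * suc t
      block : Fin (suc Q) → Fin (suc t) → Fin N
      block = combine

    -- Only pairs (offset r < rx, offset rx) inside one block change order.  Were such a pair an edge
    -- of the complement, the vertex at offset r of the first block would be a neighbour of the
    -- source x placed before it.
    moveSourceToFront : ∀ {α x} {σ : Fin N ↔ LiftV X} → IsSource X α x → IsLinExt X N α σ →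
      BlockConstant (suc Q) (suc t) σ → ∀ {rx} → Inverse.from σ x ≡ block zero rx →
      Σ (Fin N ↔ LiftV X) λ τ → IsLinExt X N α τ × BlockConstant (suc Q) (suc t) τ × Inverse.from τ x ≡ zero
    moveSourceToFront {α} {x} {σ} source extends constant {rx} at-x =
      τ , IsLinExt-reorder {σ = σ} {τ} extends keeps-order , τ-constant , x-first
      where
        μ : Permutation (suc t) (suc t)
        μ = moveToFront rx
        π : Permutation N N
        π = blockwise {suc Q} μ
        τ : Fin N ↔ LiftV X
        τ = σ ↔-∘ ↔-sym π
        x-first : Inverse.from τ x ≡ zero
        x-first = trans (cong (π ⟨$⟩ʳ_) at-x) (trans (blockwise-combine μ zero rx) (cong (block zero) (moveToFront-self rx)))
        τ-constant : BlockConstant (suc Q) (suc t) τ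
        τ-constant q q′ r = trans (cong (fibreAt σ) (blockwise-combine⁻¹ μ q r))
                              (trans (constant q q′ _) (sym (cong (fibreAt σ) (blockwise-combine⁻¹ μ q′ r))))
        position-τ : ∀ {a} q r → block q r ≡ Inverse.from σ a → position τ a ≡ toℕ (block q (μ ⟨$⟩ʳ r))
        position-τ q r at = cong toℕ (trans (cong (π ⟨$⟩ʳ_) (sym at)) (blockwise-combine μ q r))
        fibre-at : ∀ {a} q r → block q r ≡ Inverse.from σ a → fibreAt σ (block q r) ≡ proj X a
        fibre-at {a} q r at = trans (cong (fibreAt σ) at) (fibreAt-from σ a)
        keeps-order : ∀ {u v} → CompEdge X u v → position σ u < position σ v → position τ u < position τ v
        keeps-order {u} {v} ce lt
          with combine-surjective {suc Q} {suc t} (Inverse.from σ u) | combine-surjective {suc Q} {suc t} (Inverse.from σ v)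
        ... | qu , ru , at-u | qv , rv , at-v
          with combine-<-lex qu qv ru rv (subst₂ (λ a b → toℕ a < toℕ b) (sym at-u) (sym at-v) lt)
        ...   | inj₁ qu<qv = subst₂ _<_ (sym (position-τ qu ru at-u)) (sym (position-τ qv rv at-v)) (combine-monoˡ-< _ _ qu<qv)
        ...   | inj₂ (refl , ru<rv) with rv ≟ᶠ rx
        ...     | no rv≢rx = subst₂ _<_ (sym (position-τ qu ru at-u)) (sym (position-τ qv rv at-v))
                               (combine-monoʳ-< qu (moveToFront-mono rx ru<rv rv≢rx))
        ...     | yes refl = ⊥-elim (<-asym ru<rv (subst₂ _<_ x-position z-position
                               (source-precedes {σ = σ} source extends (CompEdge-sym ce) x~v z~u z≢x)))
          where
            z : LiftV X
            z = Inverse.to σ (block zero ru)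
            z-position : position σ z ≡ toℕ ru
            z-position = trans (position-to σ _) (toℕ-combine-zero {Q} ru)
            x-position : position σ x ≡ toℕ rv
            x-position = trans (cong toℕ at-x) (toℕ-combine-zero {Q} rv)
            x~v : proj X x ≡ proj X v
            x~v = trans (sym (fibre-at zero rx (sym at-x))) (trans (constant zero qu rv) (fibre-at qu rv at-v))
            z~u : proj X z ≡ proj X u
            z~u = trans (constant zero qu ru) (fibre-at qu ru at-u)
            z≢x : z ≢ x
            z≢x z≡x = <-irrefl (trans (sym z-position) (trans (cong (position σ) z≡x) x-position)) ru<rv

    BlockConstant-rotate : ∀ {σ : Fin N ↔ LiftV X} → BlockConstant (suc Q) (suc t) σ →
      BlockConstant (suc Q) (suc t) (σ ↔-∘ rotate)
    BlockConstant-rotate {σ} constant q q′ r = trans (to-first q) (sym (to-first q′))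
      where
        to-first : ∀ q → fibreAt σ (φ (block q r)) ≡ fibreAt σ (block zero (φ r))
        to-first q with φ-combine q r
        ... | q₁ , next = trans (cong (fibreAt σ) next) (constant q₁ zero (φ r))

    -- A source outside the first block has no neighbour in the complement, so its flip changes no arc.
    BlockExt-flipSource : ∀ {α β x} → IsSource X α x → FlipsAt α β x →
      BlockExt α (suc Q) (suc t) → BlockExt β (suc Q) (suc t)
    BlockExt-flipSource {α} {β} {x} source flips (σ , extends , constant)
      with combine-surjective {suc Q} {suc t} (Inverse.from σ x)
    ... | zero , rx , at-x =
      let τ , τ-extends , τ-constant , x-first = moveSourceToFront {σ = σ} source extends constant (sym at-x)
      in τ ↔-∘ rotate , IsLinExt-rotateSource {σ = τ} source flips τ-extends x-first , BlockConstant-rotate {σ = τ} τ-constant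
    ... | suc q , rx , at-x = σ , IsLinExt-flipIsolated {σ = σ} flips isolated extends , constant
      where
        later : suc t ≤ position σ x
        later = subst (suc t ≤_) (trans (sym (toℕ-↑ʳ (suc t) (combine q rx))) (cong toℕ at-x)) (m≤m+n (suc t) _)
        isolated : ∀ y → ¬ CompEdge X x y
        isolated y ce = <⇒≱ (source-in-first-block {Q = Q} {σ = σ} source extends constant ce) later

  BlockExt-flipSink : ∀ {α β x Q t} → IsSink X α x → FlipsAt α β x →
    BlockExt α (suc Q) (suc t) → BlockExt β (suc Q) (suc t)
  BlockExt-flipSink {α} {β} {x} sink (flip-x , flip-other) = BlockExt-ᵒᵖ ∘ BlockExt-flipSource sink flips-ᵒᵖ ∘ BlockExt-ᵒᵖ
    where
      flips-ᵒᵖ : FlipsAt (α ᵒᵖ) (β ᵒᵖ) x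
      flips-ᵒᵖ = (λ u v at-x → flip-x v u (swap at-x)) , λ u v u≢x v≢x → flip-other v u v≢x u≢x

  FlipsAt-sym : ∀ {α β x} → FlipsAt α β x → FlipsAt β α x
  FlipsAt-sym (flip-x , flip-other) =
    (λ u v at-x → sym (flip-x v u (swap at-x))) , λ u v u≢x v≢x → sym (flip-other u v u≢x v≢x)

  FlipStep-sym : ∀ {α β} → FlipStep X α β → FlipStep X β α
  FlipStep-sym (x , inj₁ source , flips) =
    x , inj₂ (λ y ce → trans (proj₁ flips y x (inj₂ refl)) (source y ce)) , FlipsAt-sym flips
  FlipStep-sym (x , inj₂ sink , flips) =
    x , inj₁ (λ y ce → trans (proj₁ flips x y (inj₁ refl)) (sink y ce)) , FlipsAt-sym flips

  ToricSymEquiv-sym : ∀ {α β} → ToricSymEquiv X α β → ToricSymEquiv X β α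
  ToricSymEquiv-sym = Star.reverse [ inj₁ ∘ Star.reverse FlipStep-sym , inj₂ ∘ SymEquiv-sym ]′

  BlockExt-Toric : ∀ {α β Q t} → Toric X α β → BlockExt α (suc Q) (suc t) → BlockExt β (suc Q) (suc t)
  BlockExt-Toric ε = λ ext → ext
  BlockExt-Toric ((x , inj₁ source , flips) ◅ steps) = BlockExt-Toric steps ∘ BlockExt-flipSource source flips
  BlockExt-Toric ((x , inj₂ sink   , flips) ◅ steps) = BlockExt-Toric steps ∘ BlockExt-flipSink sink flips

  BlockExt-≃ : ∀ {α β Q t} → ToricSymEquiv X α β → BlockExt α (suc Q) (suc t) → BlockExt β (suc Q) (suc t)
  BlockExt-≃ ε = λ ext → ext
  BlockExt-≃ (inj₁ toric    ◅ steps) = BlockExt-≃ steps ∘ BlockExt-Toric toric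
  BlockExt-≃ (inj₂ symEquiv ◅ steps) = BlockExt-≃ steps ∘ BlockExt-SymEquiv symEquiv

  -- The least period divides n, so the extension is block constant.
  PeriodOf-≃ : ∀ {n α β t} {σ : Fin n ↔ LiftV X} → ToricSymEquiv X α β → IsLinExt X n α σ → PeriodOf X n σ t →
    PeriodicLinExt n β t
  PeriodOf-≃ {t = zero} _ _ ((() , _) , _)
  PeriodOf-≃ {t = suc t} {σ} α≃β extends least with least-period-divides σ least
  ... | zero  , refl = σ , (λ x → case Inverse.from σ x of λ ()) , proj₁ least
  ... | suc Q , refl =
    let τ , τ-extends , τ-constant = BlockExt-≃ {Q = Q} α≃β (σ , extends , IsPeriodOf⇒BlockConstant {suc Q} σ (proj₁ least))
    in τ , τ-extends , BlockConstant⇒IsPeriodOf {suc Q} τ (s≤s z≤n) τ-constant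

  PeriodicLinExt-≃ : ∀ {n α β s} → ToricSymEquiv X α β → PeriodicLinExt n α s →
    Σ ℕ λ s′ → s′ ≤ s × PeriodicLinExt n β s′
  PeriodicLinExt-≃ α≃β (σ , extends , s-period) =
    let t , t≤s , least = least-period σ s-period in t , t≤s , PeriodOf-≃ {σ = σ} α≃β extends least

  LeastPeriod : ℕ → Orient X → ℕ → Set
  LeastPeriod n O t = PeriodicLinExt n O t × (∀ s → PeriodicLinExt n O s → t ≤ s)

  LeastPeriod-≃ : ∀ {n α β t} → ToricSymEquiv X α β → LeastPeriod n α t → LeastPeriod n β t
  LeastPeriod-≃ {n} {β = β} {t} α≃β (α-periodic , α-least) with PeriodicLinExt-≃ α≃β α-periodic
  ... | s , s≤t , β-periodic = subst (PeriodicLinExt n β) (≤-antisym s≤t (β-least s β-periodic)) β-periodic , β-least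
    where
      β-least : ∀ s → PeriodicLinExt n β s → t ≤ s
      β-least s periodic with PeriodicLinExt-≃ (ToricSymEquiv-sym α≃β) periodic
      ... | s′ , s′≤s , α-periodic′ = ≤-trans (α-least s′ α-periodic′) s′≤s

  LeastPeriod⇒OrientPeriod : ∀ {n O t} → LeastPeriod n O t → OrientPeriod X n O t
  LeastPeriod⇒OrientPeriod ((σ , extends , t-period) , least) =
      (σ , extends , t-period , λ s s-period → least s (σ , extends , s-period))
    , λ σ′ s extends′ s-least → least s (σ′ , extends′ , proj₁ s-least)

proposition5p5 : (X : MultGraph) → Connected X → (n : ℕ) → n ≡ totalMult X →
    (α β : Orient X) → AcyclicOrientation X α → AcyclicOrientation X β →
    ToricSymEquiv X α β →
    Σ ℕ (λ t → OrientPeriod X n α t × OrientPeriod X n β t)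
proposition5p5 X _ n refl α β α-acyclic _ α≃β =
  let σ , extends = linear-extension-exists X α-acyclic
      t , least = least-witness (PeriodicLinExt? X n α) (σ , extends , proj₂ (period-exists X σ))
  in t , LeastPeriod⇒OrientPeriod X least , LeastPeriod⇒OrientPeriod X (LeastPeriod-≃ X α≃β least)
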